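{- Let $\mathbf{L}=\langle L,\leq,\otimes,\rightarrow,0,1\rangle$ be a complete residuated lattice, $Y\neq\emptyset$, and ${}^*$ an idempotent truth-stressing hedge. An operator $C\colon L^Y\to L^Y$ is an $\mathbf{L}^*$-closure operator if and only if it is an $\mathbf{S}$-closure operator for $S=\{\langle f_{a^*},h_{a^*}\rangle;\ a\in L\}$, where $f_c(B)=c\otimes B$ and $h_c(B)=c\rightarrow B$ for $B\in L^Y$; that is, iff for all $A,B\in L^Y$ and $a\in L$: $A\subseteq C(A)$, $A\subseteq B$ implies $C(A)\subseteq C(B)$, and $C(a^*\rightarrow C(A))\subseteq a^*\rightarrow C(A)$.
   Context: Complete residuated lattice: $\langle L,\leq\rangle$ complete lattice with bounds $0,1$, $\otimes$ associative, commutative, neutral $1$, $a\otimes b\leq c$ iff $b\leq a\rightarrow c$. $L^Y$: maps $Y\to L$; $A\subseteq B$ iff $A(y)\leq B(y)$ for all $y$; $(c\otimes B)(y)=c\otimes B(y)$, $(c\rightarrow B)(y)=c\rightarrow B(y)$; $S(A,B)=\bigwedge_{y}(A(y)\rightarrow B(y))$. Idempotent truth-stressing hedge: ${}^*\colon L\to L$ with $1^*=1$, $a^*\leq a$, $(a\rightarrow b)^*\leq a^*\rightarrow b^*$, $a^{**}=a^*$. $\mathbf{L}^*$-closure operator: $A\subseteq C(A)$, $S(A,B)^*\leq S(C(A),C(B))$, $C(C(A))\subseteq C(A)$ for all $A,B$. The pairs $\langle f_{a^*},h_{a^*}\rangle$ are isotone Galois connections on $\langle L^Y,\subseteq\rangle$;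 an $S$-closure operator for a set $S$ of isotone Galois connections containing the identity pair is a $C$ that is extensive, monotone, and satisfies $C(h(C(A)))\subseteq h(C(A))$ for all $\langle f,h\rangle\in S$. -}

module Defs where

open import Level using (Level; suc; _⊔_)
open import Data.Product using (_×_; _,_)
open import Relation.Binary.PropositionalEquality using (_≡_)
open import Relation.Binary.Structures using (IsPartialOrder)

record CompleteResiduatedLattice : Set₁ where
  infixr 7 _⊗_
  infixr 5 _⇒_
  infix 4 _≤_
  field
    Carrier  : Set
    _≤_      : Carrier → Carrier → Set
    isPartialOrder : IsPartialOrder _≡_ _≤_
    ⋀        : {I : Set} → (I → Carrier) → Carrier
    ⋀-lower  : {I : Set} (f : I → Carrier) (i : I) → ⋀ f ≤ f i
    ⋀-greatest : {I : Set} (f : I → Carrier) (c : Carrier) → (∀ i → c ≤ f i) → c ≤ ⋀ f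
    ⋁        : {I : Set} → (I → Carrier) → Carrier
    ⋁-upper  : {I : Set} (f : I → Carrier) (i : I) → f i ≤ ⋁ f
    ⋁-least  : {I : Set} (f : I → Carrier) (c : Carrier) → (∀ i → f i ≤ c) → ⋁ f ≤ c
    𝟘 𝟙      : Carrier
    𝟘-least  : ∀ a → 𝟘 ≤ a
    𝟙-greatest : ∀ a → a ≤ 𝟙
    _⊗_      : Carrier → Carrier → Carrier
    _⇒_      : Carrier → Carrier → Carrier
    ⊗-assoc  : ∀ a b c → (a ⊗ b) ⊗ c ≡ a ⊗ (b ⊗ c)
    ⊗-comm   : ∀ a b → a ⊗ b ≡ b ⊗ a
    ⊗-identityˡ : ∀ a → 𝟙 ⊗ a ≡ a
    residuation : ∀ a b c → ((a ⊗ b ≤ c) → (b ≤ a ⇒ c)) × ((b ≤ a ⇒ c) → (a ⊗ b ≤ c))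

module _ (𝐋 : CompleteResiduatedLattice) where
  open CompleteResiduatedLattice 𝐋

  record IsIdempotentHedge (_* : Carrier → Carrier) : Set where
    field
      𝟙*      : 𝟙 * ≡ 𝟙
      subdiag : ∀ a → a * ≤ a
      ⇒*      : ∀ a b → (a ⇒ b) * ≤ (a *) ⇒ (b *)
      idem    : ∀ a → (a *) * ≡ a *

  LSet : Set → Set
  LSet Y = Y → Carrier

  _⊆_ : {Y : Set} → LSet Y → LSet Y → Set
  A ⊆ B = ∀ y → A y ≤ B y

  _⇒ˢ_ : {Y : Set} → Carrier → LSet Y → LSet Y
  (c ⇒ˢ B) y = c ⇒ B y

  _⊗ˢ_ : {Y : Set} → Carrier → LSet Y → LSet Y
  (c ⊗ˢ B) y = c ⊗ B y

  Sub : {Y : Set} → LSet Y → LSet Y → Carrier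
  Sub A B = ⋀ (λ y → A y ⇒ B y)

  IsLStarClosure : {Y : Set} (_* : Carrier → Carrier) → (LSet Y → LSet Y) → Set
  IsLStarClosure _* C =
      (∀ A → A ⊆ C A)
    × (∀ A B → (Sub A B) * ≤ Sub (C A) (C B))
    × (∀ A → C (C A) ⊆ C A)

  IsSClosureHedge : {Y : Set} (_* : Carrier → Carrier) → (LSet Y → LSet Y) → Set
  IsSClosureHedge _* C =
      (∀ A → A ⊆ C A)
    × (∀ A B → A ⊆ B → C A ⊆ C B)
    × (∀ (a : Carrier) A → C ((a *) ⇒ˢ C A) ⊆ ((a *) ⇒ˢ C A))

module Submission where

-- Everything rests on the adjunction  c ≤ S(A,B)  iff  A ⊆ c ⇒ B.  With c = S(A,B)*
-- (a fixpoint of the hedge), compatibility of C with S becomes: A ⊆ c ⇒ C B implies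
-- C A ⊆ c ⇒ C B, which monotonicity reduces to closure of C under c ⇒ _; with c = 𝟙 it
-- gives monotonicity, and closure under 𝟙 ⇒ _ = id is idempotency.

open import Data.Product using (_,_; proj₁; proj₂)
open import Function.Bundles using (_⇔_; mk⇔)
open import Relation.Binary.PropositionalEquality using (_≡_; sym; trans; cong; subst)
open import Relation.Binary.Structures using (IsPartialOrder)
open import Defs using (CompleteResiduatedLattice; IsIdempotentHedge; LSet; IsLStarClosure; IsSClosureHedge)
import Defs

module _ (𝐋 : CompleteResiduatedLattice) where
  open CompleteResiduatedLattice 𝐋
  open IsPartialOrder isPartialOrder
    using (reflexive) renaming (refl to ≤-refl; trans to ≤-trans; antisym to ≤-antisym)

  private
    infix 4 _⊆_
    infixr 5 _⇒ˢ_

    _⊆_ : {Y : Set} → LSet 𝐋 Y → LSet 𝐋 Y → Set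
    _⊆_ = Defs._⊆_ 𝐋

    _⇒ˢ_ : {Y : Set} → Carrier → LSet 𝐋 Y → LSet 𝐋 Y
    _⇒ˢ_ = Defs._⇒ˢ_ 𝐋

    Sub : {Y : Set} → LSet 𝐋 Y → LSet 𝐋 Y → Carrier
    Sub = Defs.Sub 𝐋

  curry : ∀ {a b c} → a ⊗ b ≤ c → b ≤ a ⇒ c
  curry {a} {b} {c} = proj₁ (residuation a b c)

  uncurry : ∀ {a b c} → b ≤ a ⇒ c → a ⊗ b ≤ c
  uncurry {a} {b} {c} = proj₂ (residuation a b c)

  ⇒-exchange : ∀ {a b c} → c ≤ a ⇒ b → a ≤ c ⇒ b
  ⇒-exchange {a} {b} {c} c≤a⇒b = curry (subst (_≤ b) (⊗-comm a c) (uncurry c≤a⇒b))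

  ⇒-monoʳ : ∀ {a b c} → b ≤ c → a ⇒ b ≤ a ⇒ c
  ⇒-monoʳ b≤c = curry (≤-trans (uncurry ≤-refl) b≤c)

  ⇒-identityˡ : ∀ b → 𝟙 ⇒ b ≡ b
  ⇒-identityˡ b = ≤-antisym
    (subst (_≤ b) (⊗-identityˡ (𝟙 ⇒ b)) (uncurry ≤-refl))
    (curry (reflexive (⊗-identityˡ b)))

  ⇒-internalise : ∀ {a b} → a ≤ b → 𝟙 ≤ a ⇒ b
  ⇒-internalise {b = b} a≤b = ⇒-exchange (≤-trans a≤b (reflexive (sym (⇒-identityˡ b))))

  ⇒-externalise : ∀ {a b} → 𝟙 ≤ a ⇒ b → a ≤ b
  ⇒-externalise {b = b} 𝟙≤a⇒b = ≤-trans (⇒-exchange 𝟙≤a⇒b) (reflexive (⇒-identityˡ b))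

  𝟙≤-≡𝟙 : ∀ {a} → 𝟙 ≤ a → a ≡ 𝟙
  𝟙≤-≡𝟙 {a} 𝟙≤a = ≤-antisym (𝟙-greatest a) 𝟙≤a

  ⊆-refl : {Y : Set} {A : LSet 𝐋 Y} → A ⊆ A
  ⊆-refl y = ≤-refl

  ⊆-trans : {Y : Set} {A B D : LSet 𝐋 Y} → A ⊆ B → B ⊆ D → A ⊆ D
  ⊆-trans A⊆B B⊆D y = ≤-trans (A⊆B y) (B⊆D y)

  ⊆-𝟙⇒ˢ : {Y : Set} {A : LSet 𝐋 Y} → A ⊆ 𝟙 ⇒ˢ A
  ⊆-𝟙⇒ˢ y = reflexive (sym (⇒-identityˡ _))

  𝟙⇒ˢ-⊆ : {Y : Set} {A : LSet 𝐋 Y} → 𝟙 ⇒ˢ A ⊆ A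
  𝟙⇒ˢ-⊆ y = reflexive (⇒-identityˡ _)

  Sub-greatest : {Y : Set} {A B : LSet 𝐋 Y} {c : Carrier} → A ⊆ c ⇒ˢ B → c ≤ Sub A B
  Sub-greatest A⊆c⇒B = ⋀-greatest _ _ (λ y → ⇒-exchange (A⊆c⇒B y))

  Sub-elim : {Y : Set} {A B : LSet 𝐋 Y} {c : Carrier} → c ≤ Sub A B → A ⊆ c ⇒ˢ B
  Sub-elim c≤Sub y = ⇒-exchange (≤-trans c≤Sub (⋀-lower _ y))

  Sub-monoʳ : {Y : Set} {A B D : LSet 𝐋 Y} → B ⊆ D → Sub A B ≤ Sub A D
  Sub-monoʳ B⊆D = Sub-greatest (⊆-trans (Sub-elim ≤-refl) (λ y → ⇒-monoʳ (B⊆D y)))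

  module Hedge {_* : Carrier → Carrier} (hedge : IsIdempotentHedge 𝐋 _*) where
    open IsIdempotentHedge hedge

    𝟙≤-hedge : ∀ {a} → 𝟙 ≤ a → 𝟙 ≤ a *
    𝟙≤-hedge 𝟙≤a = reflexive (trans (sym 𝟙*) (cong _* (sym (𝟙≤-≡𝟙 𝟙≤a))))

    *-mono : ∀ {a b} → a ≤ b → a * ≤ b *
    *-mono {a} {b} a≤b = ⇒-externalise (≤-trans (𝟙≤-hedge (⇒-internalise a≤b)) (⇒* a b))

    *-≤-stable : ∀ {a b} → a * ≤ b → a * ≤ b *
    *-≤-stable {a} {b} a*≤b = subst (_≤ b *) (idem a) (*-mono a*≤b)

  module Closure {_* : Carrier → Carrier} (hedge : IsIdempotentHedge 𝐋 _*)
                 {Y : Set} (C : LSet 𝐋 Y → LSet 𝐋 Y) where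
    open IsIdempotentHedge hedge
    open Hedge hedge

    Extensive Monotone Idempotent SubCompatible ResidualClosed : Set
    Extensive      = ∀ A → A ⊆ C A
    Monotone       = ∀ A B → A ⊆ B → C A ⊆ C B
    Idempotent     = ∀ A → C (C A) ⊆ C A
    SubCompatible  = ∀ A B → (Sub A B) * ≤ Sub (C A) (C B)
    ResidualClosed = ∀ a A → C (a * ⇒ˢ C A) ⊆ a * ⇒ˢ C A

    subCompatible⇒monotone : SubCompatible → Monotone
    subCompatible⇒monotone compatible A B A⊆B =
      ⊆-trans (Sub-elim 𝟙≤Sub[CA,CB]) 𝟙⇒ˢ-⊆
      where
      𝟙≤Sub[CA,CB] : 𝟙 ≤ Sub (C A) (C B)
      𝟙≤Sub[CA,CB] = ≤-trans (𝟙≤-hedge (Sub-greatest (⊆-trans A⊆B ⊆-𝟙⇒ˢ))) (compatible A B)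

    subCompatible∧idempotent⇒residualClosed : SubCompatible → Idempotent → ResidualClosed
    subCompatible∧idempotent⇒residualClosed compatible idempotent a A =
      Sub-elim (≤-trans (*-≤-stable (Sub-greatest ⊆-refl)) compatible′)
      where
      compatible′ : (Sub (a * ⇒ˢ C A) (C A)) * ≤ Sub (C (a * ⇒ˢ C A)) (C A)
      compatible′ = ≤-trans (compatible _ _) (Sub-monoʳ (idempotent A))

    monotone∧residualClosed⇒idempotent : Monotone → ResidualClosed → Idempotent
    monotone∧residualClosed⇒idempotent monotone closed A =
      ⊆-trans (monotone _ _ ⊆-𝟙⇒ˢ) (⊆-trans residual-𝟙 𝟙⇒ˢ-⊆)
      where
      residual-𝟙 : C (𝟙 ⇒ˢ C A) ⊆ 𝟙 ⇒ˢ C A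
      residual-𝟙 = subst (λ u → C (u ⇒ˢ C A) ⊆ u ⇒ˢ C A) 𝟙* (closed 𝟙 A)

    extensive∧monotone∧residualClosed⇒subCompatible :
      Extensive → Monotone → ResidualClosed → SubCompatible
    extensive∧monotone∧residualClosed⇒subCompatible extensive monotone closed A B =
      Sub-greatest (⊆-trans (monotone _ _ A⊆s⇒CB) (closed (Sub A B) B))
      where
      A⊆s⇒CB : A ⊆ (Sub A B) * ⇒ˢ C B
      A⊆s⇒CB = Sub-elim (≤-trans (subdiag _) (Sub-monoʳ (extensive B)))

corollary8 : (𝐋 : CompleteResiduatedLattice)
    → (_* : CompleteResiduatedLattice.Carrier 𝐋 → CompleteResiduatedLattice.Carrier 𝐋)
    → IsIdempotentHedge 𝐋 _*
    → (Y : Set) → Y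
    → (C : LSet 𝐋 Y → LSet 𝐋 Y)
    → IsLStarClosure 𝐋 _* C ⇔ IsSClosureHedge 𝐋 _* C
corollary8 𝐋 _* hedge Y _ C = mk⇔
  (λ (extensive , compatible , idempotent) →
      extensive
    , subCompatible⇒monotone compatible
    , subCompatible∧idempotent⇒residualClosed compatible idempotent)
  (λ (extensive , monotone , closed) →
      extensive
    , extensive∧monotone∧residualClosed⇒subCompatible extensive monotone closed
    , monotone∧residualClosed⇒idempotent monotone closed)
  where open Closure 𝐋 hedge C
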